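{- Let $G$ and $H$ be graphs such that $H$ is strictly $2$-balanced, $\delta(H)\ge 2$ and $m_2(H)-\lfloor m_2(H)\rfloor\le 1/2$. If $\vec H$ is an anti-directed orientation of $H$ and $m(G)<m_2(H)$, then $G\not\to\vec H$, i.e., $G$ has an orientation containing no copy of $\vec H$.
   Context: $m(G)=\max\{e(J)/v(J):J\subseteq G,\ v(J)\ge1\}$ and $m_2(G)=\max\{(e(J)-1)/(v(J)-2):J\subseteq G,\ v(J)\ge3\}$. $H$ is strictly $2$-balanced if $m_2(F)<m_2(H)$ for every proper subgraph $F\subseteq H$. An oriented graph is anti-directed if each vertex has either no in-neighbours or no out-neighbours. -}

module Defs where

open import Data.Nat as ℕ using (ℕ; zero; suc; _∸_; _<ᵇ_)
open import Data.Integer as ℤ using (ℤ; +_)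
open import Data.Rational as ℚ using (ℚ; 0ℚ)
open import Data.Bool using (Bool; true; false; _∧_; if_then_else_)
open import Data.Fin using (Fin; toℕ)
open import Data.List using (List; map; allFin)
open import Data.Nat.ListAction using (sum)
open import Data.Product using (Σ; _×_; _,_)
open import Data.Sum using (_⊎_)
open import Relation.Binary.PropositionalEquality using (_≡_; _≢_)
open import Relation.Nullary using (¬_)
open import Function.Definitions using (Injective)

record Graph : Set where
  field
    V     : ℕ
    adj   : Fin V → Fin V → Bool
    sym   : ∀ u v → adj u v ≡ adj v u
    irrefl : ∀ v → adj v v ≡ false
open Graph public

count₁ : ∀ {n} → (Fin n → Bool) → ℕ
count₁ {n} f = sum (map (λ u → if f u then 1 else 0) (allFin n))

countPairs : ∀ {n} → (Fin n → Fin n → Bool) → ℕ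
countPairs {n} r =
  sum (map (λ u → sum (map (λ v → if r u v ∧ (toℕ u <ᵇ toℕ v) then 1 else 0) (allFin n))) (allFin n))

record Sub (G : Graph) : Set where
  field
    vs    : Fin (V G) → Bool
    es    : Fin (V G) → Fin (V G) → Bool
    es-sym : ∀ u v → es u v ≡ es v u
    es-adj : ∀ u v → es u v ≡ true → adj G u v ≡ true
    es-vs  : ∀ u v → es u v ≡ true → vs u ≡ true
open Sub public

vJ : ∀ {G} → Sub G → ℕ
vJ J = count₁ (vs J)

eJ : ∀ {G} → Sub G → ℕ
eJ J = countPairs (es J)

_⊆ₛ_ : ∀ {G} → Sub G → Sub G → Set
J ⊆ₛ F = (∀ u → vs J u ≡ true → vs F u ≡ true) × (∀ u v → es J u v ≡ true → es F u v ≡ true)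

full : (G : Graph) → Sub G
full G = record { vs = λ _ → true ; es = adj G ; es-sym = sym G
                ; es-adj = λ _ _ e → e ; es-vs = λ _ _ _ → _≡_.refl }

Proper : ∀ {G} → Sub G → Set
Proper {G} F = ¬ (full G ⊆ₛ F)

-- the rational p / d, with the (unused) convention p / 0 = 0
frac : ℤ → ℕ → ℚ
frac p zero = 0ℚ
frac p (suc k) = p ℚ./ suc k

dens : ∀ {G} → Sub G → ℚ
dens J = frac (+ eJ J) (vJ J)

dens₂ : ∀ {G} → Sub G → ℚ
dens₂ J = frac (+ eJ J ℤ.- + 1) (vJ J ∸ 2)

IsM : ∀ {G} → Sub G → ℚ → Set
IsM F q = (Σ (Sub _) λ J → J ⊆ₛ F × 1 ℕ.≤ vJ J × dens J ≡ q)
        × (∀ J → J ⊆ₛ F → 1 ℕ.≤ vJ J → dens J ℚ.≤ q)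

IsM₂ : ∀ {G} → Sub G → ℚ → Set
IsM₂ F q = (Σ (Sub _) λ J → J ⊆ₛ F × 3 ℕ.≤ vJ J × dens₂ J ≡ q)
         × (∀ J → J ⊆ₛ F → 3 ℕ.≤ vJ J → dens₂ J ℚ.≤ q)

-- H strictly 2-balanced: m₂(F) < m₂(H) for every proper subgraph F ⊆ H
-- (for F on at most 2 vertices m₂(F) is undefined and there is no such value)
StrictlyTwoBalanced : Graph → Set
StrictlyTwoBalanced H =
  ∀ q → IsM₂ (full H) q → ∀ (F : Sub H) → Proper F → ∀ r → IsM₂ F r → r ℚ.< q

degree : (G : Graph) → Fin (V G) → ℕ
degree G v = count₁ (adj G v)

MinDeg≥2 : Graph → Set
MinDeg≥2 G = ∀ v → 2 ℕ.≤ degree G v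

record Orientation (G : Graph) : Set where
  field
    arc     : Fin (V G) → Fin (V G) → Bool
    arc-adj : ∀ u v → arc u v ≡ true → adj G u v ≡ true
    arc-one : ∀ u v → adj G u v ≡ true →
              (arc u v ≡ true × arc v u ≡ false) ⊎ (arc u v ≡ false × arc v u ≡ true)
open Orientation public

AntiDirected : ∀ {G} → Orientation G → Set
AntiDirected D = ∀ v → (∀ u → arc D u v ≡ false) ⊎ (∀ u → arc D v u ≡ false)

Copy : ∀ {H G} → Orientation H → Orientation G → Set
Copy {H} {G} Hₒ Gₒ =
  Σ (Fin (V H) → Fin (V G)) λ φ →
    Injective _≡_ _≡_ φ × (∀ u v → arc Hₒ u v ≡ true → arc Gₒ (φ u) (φ v) ≡ true)

module Submission where

-- Let k = ⌊m₂(H)⌋; the hypothesis on the fractional part says m₂(H) ≤ k + ½.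
-- Then every subgraph of G has average degree 2 m(G) < 2k + 1, so G is 2k-degenerate.
-- On the other side every vertex of H has degree > k: otherwise deleting a vertex of
-- degree ≤ k ≤ m₂(H) would not lower the 2-density, contradicting strict 2-balancedness
-- (when v(H) ≥ 4), or H is a triangle, which has no anti-directed orientation.
-- Orient G by adding its vertices back in reverse degeneracy order, directing at most k
-- edges out of and at most k edges into each new vertex x towards earlier vertices.
-- A copy of Hₒ through the last-added vertex x maps a source or sink h of Hₒ onto x,
-- so x would need deg(h) > k out- or in-neighbours, which it does not have.

open import Defs renaming (sym to adj-sym)
open import Data.Nat as ℕ using (ℕ; zero; suc; _+_; _*_; _∸_; _≤_; _<_; z≤n; s≤s; _<ᵇ_)
import Data.Nat.Properties as ℕP
import Data.Nat.ListAction as List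
open import Data.Nat.DivMod using (m/n*n≤m)
open import Data.Nat.Coprimality using (Coprime)
open import Data.Integer as ℤ using (ℤ; +_; -[1+_])
import Data.Integer.Properties as ℤP
open import Data.Integer.DivMod using (div-pos-is-/ℕ)
open import Data.Rational as ℚ using (ℚ; mkℚ; ↥_; ↧_; toℚᵘ; ½; floor; 0ℚ)
import Data.Rational.Properties as ℚP
open import Data.Rational.Unnormalised as ℚᵘ using (mkℚᵘ; *≤*; *<*; *≡*)
import Data.Rational.Unnormalised.Properties as ℚᵘP
import Data.Bool
open import Data.Bool using (Bool; true; false; _∧_; _∨_; not; if_then_else_; T)
open import Data.Bool.Properties using (∧-conicalˡ; ∧-conicalʳ; ∧-identityʳ; ∧-zeroʳ; ∨-identityʳ)
open import Data.Fin using (Fin; toℕ; zero; suc)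
open import Data.Fin.Patterns using (0F; 1F; 2F)
open import Data.Fin.Properties using (_≟_; 0≢1+n; suc-injective; toℕ-injective; any?)
open import Data.List using (map; allFin)
open import Data.List.Properties using (map-tabulate)
open import Data.Product using (Σ; _×_; _,_; proj₁; proj₂)
open import Data.Sum using (_⊎_; inj₁; inj₂)
open import Data.Empty using (⊥; ⊥-elim)
open import Function using (_∘_)
open import Function.Definitions using (Injective)
open import Relation.Binary.PropositionalEquality hiding (J)
open import Relation.Nullary using (¬_; does; yes; no)
open import Relation.Nullary.Decidable using (dec-true; dec-false; _×-dec_)
open import Algebra.Properties.Semiring.Sum ℕP.+-*-semiring
  using (sum; sum-cong-≗; sum-replicate-zero; ∑-distrib-+; ∑-comm; *-distribˡ-sum)
open import Algebra.Properties.CommutativeSemigroup ℕP.+-commutativeSemigroup using (x∙yz≈y∙xz)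
import Data.Integer.Tactic.RingSolver as ℤ-Solver
import Data.Nat.Tactic.RingSolver as ℕ-Solver

indicator : Bool → ℕ
indicator b = if b then 1 else 0

count : ∀ {n} → (Fin n → Bool) → ℕ
count P = sum (λ i → indicator (P i))

_==_ : ∀ {n} → Fin n → Fin n → Bool
u == v = does (u ≟ v)

_∖_ : ∀ {n} → (Fin n → Bool) → Fin n → Fin n → Bool
(S ∖ x) i = S i ∧ not (i == x)

sum-allFin : ∀ {n} (g : Fin n → ℕ) → List.sum (map g (allFin n)) ≡ sum g
sum-allFin g = trans (cong List.sum (map-tabulate (λ i → i) g)) (sum-tabulate g)
  where
  sum-tabulate : ∀ {n} (f : Fin n → ℕ) → List.sum (Data.List.tabulate f) ≡ sum f
  sum-tabulate {zero} f = refl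
  sum-tabulate {suc n} f = cong (λ s → f zero + s) (sum-tabulate (f ∘ suc))

count₁≡count : ∀ {n} (P : Fin n → Bool) → count₁ P ≡ count P
count₁≡count P = sum-allFin (λ i → indicator (P i))

sum-exchange : ∀ {n} (x : Fin n) {f g : Fin n → ℕ} →
               (∀ i → i ≢ x → f i ≡ g i) → f x + sum g ≡ g x + sum f
sum-exchange zero {f} {g} f≗g = begin
  f zero + (g zero + sum (g ∘ suc)) ≡⟨ cong (λ s → f zero + (g zero + s)) tails ⟩
  f zero + (g zero + sum (f ∘ suc)) ≡⟨ x∙yz≈y∙xz (f zero) (g zero) (sum (f ∘ suc)) ⟩
  g zero + (f zero + sum (f ∘ suc)) ∎
  where
  open ≡-Reasoning
  tails = sum-cong-≗ (λ i → sym (f≗g (suc i) (0≢1+n ∘ sym)))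
sum-exchange (suc x) {f} {g} f≗g = begin
  f (suc x) + (g zero + sum (g ∘ suc)) ≡⟨ x∙yz≈y∙xz (f (suc x)) (g zero) (sum (g ∘ suc)) ⟩
  g zero + (f (suc x) + sum (g ∘ suc)) ≡⟨ cong (λ s → g zero + s) (sum-exchange x (λ i i≢x → f≗g (suc i) (i≢x ∘ suc-injective))) ⟩
  g zero + (g (suc x) + sum (f ∘ suc)) ≡⟨ x∙yz≈y∙xz (g zero) (g (suc x)) (sum (f ∘ suc)) ⟩
  g (suc x) + (g zero + sum (f ∘ suc)) ≡⟨ cong (λ a → g (suc x) + (a + sum (f ∘ suc))) (sym (f≗g zero 0≢1+n)) ⟩
  g (suc x) + (f zero + sum (f ∘ suc)) ∎
  where open ≡-Reasoning

sum-supported-at : ∀ {n} (x : Fin n) {f : Fin n → ℕ} → (∀ i → i ≢ x → f i ≡ 0) → sum f ≡ f x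
sum-supported-at {n} x {f} f≗0 = begin
  sum f                ≡⟨ sum-exchange x {g = λ _ → 0} f≗0 ⟨
  f x + sum {n} (λ _ → 0)  ≡⟨ cong (λ s → f x + s) (sum-replicate-zero n) ⟩
  f x + 0              ≡⟨ ℕP.+-identityʳ (f x) ⟩
  f x                  ∎
  where open ≡-Reasoning

sum-mono-≤ : ∀ {n} {f g : Fin n → ℕ} → (∀ i → f i ≤ g i) → sum f ≤ sum g
sum-mono-≤ {zero} _ = z≤n
sum-mono-≤ {suc n} f≤g = ℕP.+-mono-≤ (f≤g zero) (sum-mono-≤ (f≤g ∘ suc))

==-refl : ∀ {n} (x : Fin n) → (x == x) ≡ true
==-refl x = dec-true (x ≟ x) refl

==-≢ : ∀ {n} {u x : Fin n} → u ≢ x → (u == x) ≡ false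
==-≢ {u = u} {x} = dec-false (u ≟ x)

==⇒≡ : ∀ {n} {u x : Fin n} → (u == x) ≡ true → u ≡ x
==⇒≡ {u = u} {x} u=x with u ≟ x
... | yes u≡x = u≡x
... | no _ with () ← u=x

≡-or-≢ : ∀ {n} (u x : Fin n) → u ≡ x ⊎ u ≢ x
≡-or-≢ u x with u ≟ x
... | yes u≡x = inj₁ u≡x
... | no u≢x = inj₂ u≢x

∖-self : ∀ {n} (S : Fin n → Bool) x → (S ∖ x) x ≡ false
∖-self S x rewrite ==-refl x = ∧-zeroʳ (S x)

∖-other : ∀ {n} (S : Fin n → Bool) {x u} → u ≢ x → (S ∖ x) u ≡ S u
∖-other S u≢x rewrite ==-≢ u≢x = ∧-identityʳ _

count-∖ : ∀ {n} (S : Fin n → Bool) x → S x ≡ true → count S ≡ suc (count (S ∖ x))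
count-∖ S x Sx = begin
  count S                          ≡⟨ cong (λ b → indicator b + count S) (∖-self S x) ⟨
  indicator ((S ∖ x) x) + count S  ≡⟨ sum-exchange x (λ i i≢x → cong indicator (∖-other S i≢x)) ⟩
  indicator (S x) + count (S ∖ x)  ≡⟨ cong (λ b → indicator b + count (S ∖ x)) Sx ⟩
  suc (count (S ∖ x))              ∎
  where open ≡-Reasoning

count-const-true : ∀ n → count {n} (λ _ → true) ≡ n
count-const-true zero = refl
count-const-true (suc n) = cong suc (count-const-true n)

count≡0⇒false : ∀ {n} (S : Fin n → Bool) → count S ≡ 0 → ∀ u → S u ≡ false
count≡0⇒false S S≡0 u with S u in Su
... | false = refl
... | true with () ← trans (sym S≡0) (count-∖ S u Su)

count≡suc⇒witness : ∀ {n} (S : Fin n → Bool) {m} → count S ≡ suc m → Σ (Fin n) λ u → S u ≡ true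
count≡suc⇒witness {zero} S ()
count≡suc⇒witness {suc n} S S≡suc with S zero in S0
... | true = zero , S0
... | false = let (u , Su) = count≡suc⇒witness (S ∘ suc) S≡suc in suc u , Su

count-mono-injective : ∀ {m n} (φ : Fin m → Fin n) → Injective _≡_ _≡_ φ →
                       (P : Fin m → Bool) (Q : Fin n → Bool) →
                       (∀ i → P i ≡ true → Q (φ i) ≡ true) → count P ≤ count Q
count-mono-injective {zero} φ φ-inj P Q P⇒Q = z≤n
count-mono-injective {suc m} φ φ-inj P Q P⇒Q with P zero in P0
... | false = count-mono-injective (φ ∘ suc) (suc-injective ∘ φ-inj) (P ∘ suc) Q (P⇒Q ∘ suc)
... | true = subst (suc (count (P ∘ suc)) ≤_) (sym (count-∖ Q (φ zero) (P⇒Q zero P0)))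
               (s≤s (count-mono-injective (φ ∘ suc) (suc-injective ∘ φ-inj) (P ∘ suc) (Q ∖ φ zero) P⇒Q∖φ0))
  where
  P⇒Q∖φ0 : ∀ i → P (suc i) ≡ true → (Q ∖ φ zero) (φ (suc i)) ≡ true
  P⇒Q∖φ0 i Pi = trans (∖-other Q (0≢1+n ∘ sym ∘ φ-inj)) (P⇒Q (suc i) Pi)

count≤size : ∀ {n} (P : Fin n → Bool) → count P ≤ n
count≤size {n} P = subst (count P ≤_) (count-const-true n)
  (count-mono-injective (λ i → i) (λ e → e) P (λ _ → true) (λ _ _ → refl))

true⇔true⇒≡ : ∀ {a b} → (a ≡ true → b ≡ true) → (b ≡ true → a ≡ true) → a ≡ b
true⇔true⇒≡ {false} {false} _ _ = refl
true⇔true⇒≡ {false} {true} _ b⇒a = b⇒a refl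
true⇔true⇒≡ {true} {false} a⇒b _ = sym (a⇒b refl)
true⇔true⇒≡ {true} {true} _ _ = refl

∨-∧-cases : ∀ a b c d e → a ∨ (b ∧ c ∨ d ∧ e) ≡ true →
            a ≡ true ⊎ (b ≡ true × c ≡ true) ⊎ (d ≡ true × e ≡ true)
∨-∧-cases true  _     _     _    _    _ = inj₁ refl
∨-∧-cases false true  true  _    _    _ = inj₂ (inj₁ (refl , refl))
∨-∧-cases false true  false true true _ = inj₂ (inj₂ (refl , refl))
∨-∧-cases false false _     true true _ = inj₂ (inj₂ (refl , refl))

<ᵇ-true⇒< : ∀ {m n} → (m <ᵇ n) ≡ true → m < n
<ᵇ-true⇒< {m} {n} m<ᵇn = ℕP.<ᵇ⇒< m n (subst T (sym m<ᵇn) _)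

<ᵇ-false⇒≮ : ∀ {m n} → (m <ᵇ n) ≡ false → ¬ m < n
<ᵇ-false⇒≮ m≮ᵇn m<n = subst T m≮ᵇn (ℕP.<⇒<ᵇ m<n)

countPairs≡sum : ∀ {n} (r : Fin n → Fin n → Bool) →
                 countPairs r ≡ sum (λ u → sum (λ v → indicator (r u v ∧ (toℕ u <ᵇ toℕ v))))
countPairs≡sum r = trans (sum-allFin (λ u → List.sum (map (pair u) (allFin _)))) (sum-cong-≗ (λ u → sum-allFin (pair u)))
  where
  pair = λ u v → indicator (r u v ∧ (toℕ u <ᵇ toℕ v))

es-irrefl : ∀ {G} (J : Sub G) v → es J v v ≡ false
es-irrefl {G} J v with es J v v in Jvv
... | false = refl
... | true with () ← trans (sym (es-adj J v v Jvv)) (irrefl G v)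

module _ {G : Graph} (J : Sub G) where

  private
    ordered : Fin (V G) → Fin (V G) → ℕ
    ordered u v = indicator (es J u v ∧ (toℕ u <ᵇ toℕ v))

  indicator-es-split : ∀ u v → indicator (es J u v) ≡ ordered u v + ordered v u
  indicator-es-split u v rewrite es-sym J v u
    with es J u v in Juv | toℕ u <ᵇ toℕ v in u<v | toℕ v <ᵇ toℕ u in v<u
  ... | false | _     | _     = refl
  ... | true  | true  | false = refl
  ... | true  | false | true  = refl
  ... | true  | true  | true  = ⊥-elim (ℕP.<-asym (<ᵇ-true⇒< {toℕ u} u<v) (<ᵇ-true⇒< {toℕ v} v<u))
  ... | true  | false | false with toℕ-injective {i = u} {j = v} (ℕP.≤-antisym (ℕP.≮⇒≥ (<ᵇ-false⇒≮ {toℕ v} v<u)) (ℕP.≮⇒≥ (<ᵇ-false⇒≮ {toℕ u} u<v)))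
  ...   | refl with () ← trans (sym Juv) (es-irrefl J u)

  handshake : sum (λ u → count (es J u)) ≡ 2 * eJ J
  handshake = begin
    sum (λ u → count (es J u))                                   ≡⟨ sum-cong-≗ (λ u → sum-cong-≗ (indicator-es-split u)) ⟩
    sum (λ u → sum (λ v → ordered u v + ordered v u))            ≡⟨ sum-cong-≗ (λ u → ∑-distrib-+ (ordered u) (λ v → ordered v u)) ⟩
    sum (λ u → sum (ordered u) + sum (λ v → ordered v u))        ≡⟨ ∑-distrib-+ (λ u → sum (ordered u)) _ ⟩
    sum (λ u → sum (ordered u)) + sum (λ u → sum (λ v → ordered v u)) ≡⟨ cong (λ s → sum (λ u → sum (ordered u)) + s) (∑-comm (λ u v → ordered v u)) ⟩
    sum (λ u → sum (ordered u)) + sum (λ v → sum (ordered v))    ≡⟨ cong (λ e → e + e) (countPairs≡sum (es J)) ⟨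
    eJ J + eJ J                                                  ≡⟨ cong (λ s → eJ J + s) (ℕP.+-identityʳ (eJ J)) ⟨
    2 * eJ J                                                     ∎
    where open ≡-Reasoning

sum-row : ∀ {n} (x : Fin n) (r : Fin n → Fin n → Bool) →
          sum (λ u → sum (λ v → indicator ((u == x) ∧ r u v))) ≡ count (r x)
sum-row {n} x r = trans (sum-supported-at x off-row) (sum-cong-≗ on-row)
  where
  off-row : ∀ u → u ≢ x → sum (λ v → indicator ((u == x) ∧ r u v)) ≡ 0
  off-row u u≢x rewrite ==-≢ u≢x = sum-replicate-zero n
  on-row : ∀ v → indicator ((x == x) ∧ r x v) ≡ indicator (r x v)
  on-row v rewrite ==-refl x = refl

_-ᵛ_ : ∀ {G} → Sub G → Fin (V G) → Sub G
_-ᵛ_ {G} J x = record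
  { vs = vs J ∖ x
  ; es = λ u v → not (u == x) ∧ (not (v == x) ∧ es J u v)
  ; es-sym = es-sym′
  ; es-adj = λ u v e → es-adj J u v (kept⇒es u v e)
  ; es-vs = λ u v e → cong₂ _∧_ (es-vs J u v (kept⇒es u v e)) (∧-conicalˡ (not (u == x)) _ e)
  }
  where
  kept⇒es : ∀ u v → not (u == x) ∧ (not (v == x) ∧ es J u v) ≡ true → es J u v ≡ true
  kept⇒es u v e = ∧-conicalʳ (not (v == x)) _ (∧-conicalʳ (not (u == x)) _ e)
  es-sym′ : ∀ u v → not (u == x) ∧ (not (v == x) ∧ es J u v) ≡ not (v == x) ∧ (not (u == x) ∧ es J v u)
  es-sym′ u v rewrite es-sym J u v with u == x | v == x
  ... | true  | true  = refl
  ... | true  | false = refl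
  ... | false | true  = refl
  ... | false | false = refl

-ᵛ-proper : ∀ {G} (J : Sub G) x → vs J x ≡ true → ¬ (J ⊆ₛ (J -ᵛ x))
-ᵛ-proper J x Jx (J⊆J-x , _) with () ← trans (sym (J⊆J-x x Jx)) (∖-self (vs J) x)

vJ-deleteVertex : ∀ {G} (J : Sub G) x → vs J x ≡ true → vJ J ≡ suc (vJ (J -ᵛ x))
vJ-deleteVertex J x Jx = begin
  vJ J                 ≡⟨ count₁≡count (vs J) ⟩
  count (vs J)         ≡⟨ count-∖ (vs J) x Jx ⟩
  suc (count (vs J ∖ x)) ≡⟨ cong suc (count₁≡count (vs J ∖ x)) ⟨
  suc (vJ (J -ᵛ x))    ∎
  where open ≡-Reasoning

eJ-deleteVertex : ∀ {G} (J : Sub G) x → eJ J ≡ eJ (J -ᵛ x) + count (es J x)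
eJ-deleteVertex J x = ℕP.*-cancelˡ-≡ _ _ 2 (begin
  2 * eJ J                                         ≡⟨ handshake J ⟨
  sum (λ u → count (es J u))                        ≡⟨ sum-cong-≗ (λ u → sum-cong-≗ (split u)) ⟩
  sum (λ u → sum (λ v → kept u v + (row u v + col u v)))       ≡⟨ sum-cong-≗ (λ u → ∑-distrib-+ (kept u) _) ⟩
  sum (λ u → sum (kept u) + sum (λ v → row u v + col u v))    ≡⟨ ∑-distrib-+ (λ u → sum (kept u)) _ ⟩
  sum (λ u → sum (kept u)) + sum (λ u → sum (λ v → row u v + col u v)) ≡⟨ cong (λ s → sum (λ u → sum (kept u)) + s) (sum-cong-≗ (λ u → ∑-distrib-+ (row u) (col u))) ⟩
  sum (λ u → sum (kept u)) + sum (λ u → sum (row u) + sum (col u)) ≡⟨ cong₂ (λ a b → a + b) (handshake (J -ᵛ x)) (∑-distrib-+ (λ u → sum (row u)) _) ⟩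
  2 * eJ (J -ᵛ x) + (sum (λ u → sum (row u)) + sum (λ u → sum (col u))) ≡⟨ cong (λ b → 2 * eJ (J -ᵛ x) + b) (cong₂ _+_ (sum-row x (es J)) columns) ⟩
  2 * eJ (J -ᵛ x) + (d + d)                        ≡⟨ cong (λ b → 2 * eJ (J -ᵛ x) + b) (cong (λ s → d + s) (ℕP.+-identityʳ d)) ⟨
  2 * eJ (J -ᵛ x) + 2 * d                          ≡⟨ ℕP.*-distribˡ-+ 2 (eJ (J -ᵛ x)) d ⟨
  2 * (eJ (J -ᵛ x) + d)                            ∎)
  where
  open ≡-Reasoning
  d = count (es J x)
  kept row col : Fin _ → Fin _ → ℕ
  kept u v = indicator (es (J -ᵛ x) u v)
  row u v = indicator ((u == x) ∧ es J u v)
  col u v = indicator ((v == x) ∧ es J u v)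
  split : ∀ u v → indicator (es J u v) ≡ kept u v + (row u v + col u v)
  split u v with u ≟ x | v ≟ x
  ... | yes refl | yes refl rewrite es-irrefl J u = refl
  ... | yes refl | no _     = sym (ℕP.+-identityʳ _)
  ... | no _     | yes refl = refl
  ... | no _     | no _     = sym (ℕP.+-identityʳ _)
  columns : sum (λ u → sum (col u)) ≡ d
  columns = begin
    sum (λ u → sum (col u))                                 ≡⟨ ∑-comm col ⟩
    sum (λ v → sum (λ u → indicator ((v == x) ∧ es J u v))) ≡⟨ sum-row x (λ v u → es J u v) ⟩
    count (λ u → es J u x)                                  ≡⟨ sum-cong-≗ (λ u → cong indicator (es-sym J u x)) ⟩
    d                                                       ∎

⊆ₛ-refl : ∀ {G} {J : Sub G} → J ⊆ₛ J
⊆ₛ-refl = (λ _ Ju → Ju) , (λ _ _ Juv → Juv)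

⊆ₛ-full : ∀ {G} {J : Sub G} → J ⊆ₛ full G
⊆ₛ-full {J = J} = (λ _ _ → refl) , es-adj J

IsM₂-attained : ∀ {G q} (F : Sub G) → IsM₂ (full G) q → 3 ≤ vJ F → dens₂ F ≡ q → IsM₂ F q
IsM₂-attained F (_ , bound) 3≤vF F≡q =
  (F , ⊆ₛ-refl {J = F} , 3≤vF , F≡q) ,
  (λ J _ → bound J (⊆ₛ-full {J = J}))

IsM₂⇒3≤V : ∀ {G q} → IsM₂ (full G) q → 3 ≤ V G
IsM₂⇒3≤V ((J , _ , 3≤vJ , _) , _) = ℕP.≤-trans 3≤vJ (subst (_≤ _) (sym (count₁≡count (vs J))) (count≤size (vs J)))

full⊆⇒dens₂≡ : ∀ {G} (J : Sub G) → full G ⊆ₛ J → dens₂ J ≡ dens₂ (full G)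
full⊆⇒dens₂≡ {G} J (vs⊇ , es⊇) = cong₂ (λ e v → frac (+ e ℤ.- + 1) (v ∸ 2)) eJ≡ vJ≡
  where
  vJ≡ : vJ J ≡ vJ (full G)
  vJ≡ = trans (count₁≡count (vs J))
          (trans (sum-cong-≗ (λ u → cong indicator (vs⊇ u refl))) (sym (count₁≡count {V G} (λ _ → true))))
  eJ≡ : eJ J ≡ eJ (full G)
  eJ≡ = trans (countPairs≡sum (es J))
          (trans (sum-cong-≗ (λ u → sum-cong-≗ (λ v → cong (λ b → indicator (b ∧ (toℕ u <ᵇ toℕ v)))
                                                  (true⇔true⇒≡ (es-adj J u v) (es⊇ u v)))))
                 (sym (countPairs≡sum (adj G))))

dens-nonNegative : ∀ {G} (J : Sub G) → 0ℚ ℚ.≤ dens J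
dens-nonNegative J with vJ J
... | zero  = ℚP.≤-refl
... | suc v = ℚP.nonNegative⁻¹ _ {{ℚP.normalize-nonNeg (eJ J) (suc v)}}

IsM-nonNegative : ∀ {G} {F : Sub G} {p} → IsM F p → 0ℚ ℚ.≤ p
IsM-nonNegative ((J , _ , _ , J≡p) , _) = subst (0ℚ ℚ.≤_) J≡p (dens-nonNegative J)

induced : (G : Graph) → (Fin (V G) → Bool) → Sub G
induced G S = record
  { vs = S
  ; es = λ u v → S u ∧ (S v ∧ adj G u v)
  ; es-sym = es-sym′
  ; es-adj = λ u v uv → ∧-conicalʳ (S v) _ (∧-conicalʳ (S u) _ uv)
  ; es-vs = λ u v uv → ∧-conicalˡ (S u) _ uv
  }
  where
  es-sym′ : ∀ u v → S u ∧ (S v ∧ adj G u v) ≡ S v ∧ (S u ∧ adj G v u)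
  es-sym′ u v rewrite adj-sym G u v with S u | S v
  ... | true  | true  = refl
  ... | true  | false = refl
  ... | false | true  = refl
  ... | false | false = refl

takeFirst : ∀ {n} → ℕ → (Fin n → Bool) → Fin n → Bool
takeFirst k P zero = P zero ∧ (0 <ᵇ k)
takeFirst k P (suc i) = takeFirst (if P zero then k ∸ 1 else k) (P ∘ suc) i

dropFirst : ∀ {n} → ℕ → (Fin n → Bool) → Fin n → Bool
dropFirst k P i = P i ∧ not (takeFirst k P i)

takeFirst⇒ : ∀ {n} k (P : Fin n → Bool) i → takeFirst k P i ≡ true → P i ≡ true
takeFirst⇒ k P zero = ∧-conicalˡ (P zero) _
takeFirst⇒ k P (suc i) = takeFirst⇒ _ (P ∘ suc) i

count-takeFirst≤ : ∀ {n} k (P : Fin n → Bool) → count (takeFirst k P) ≤ k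
count-takeFirst≤ {zero} k P = z≤n
count-takeFirst≤ {suc n} k P with P zero
count-takeFirst≤ {suc n} zero P    | true  = count-takeFirst≤ 0 (P ∘ suc)
count-takeFirst≤ {suc n} (suc k) P | true  = s≤s (count-takeFirst≤ k (P ∘ suc))
...                                | false = count-takeFirst≤ k (P ∘ suc)

count-dropFirst≤ : ∀ {n} k (P : Fin n → Bool) → count (dropFirst k P) ≤ count P ∸ k
count-dropFirst≤ {zero} k P = z≤n
count-dropFirst≤ {suc n} k P with P zero
count-dropFirst≤ {suc n} zero P    | true  = s≤s (count-dropFirst≤ 0 (P ∘ suc))
count-dropFirst≤ {suc n} (suc k) P | true  = count-dropFirst≤ k (P ∘ suc)
...                                | false = count-dropFirst≤ k (P ∘ suc)

OneWay : Bool → Bool → Set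
OneWay a b = (a ≡ true × b ≡ false) ⊎ (a ≡ false × b ≡ true)

OneWay-swap : ∀ {a b} → OneWay a b → OneWay b a
OneWay-swap (inj₁ (a , b)) = inj₂ (b , a)
OneWay-swap (inj₂ (a , b)) = inj₁ (b , a)

takeFirst-dropFirst-oneWay : ∀ {n} k (P : Fin n → Bool) i → P i ≡ true → OneWay (takeFirst k P i) (dropFirst k P i)
takeFirst-dropFirst-oneWay k P i Pi with takeFirst k P i
... | true  = inj₁ (refl , ∧-zeroʳ (P i))
... | false = inj₂ (refl , trans (∧-identityʳ (P i)) Pi)

Source Sink : ∀ {G} → Orientation G → Fin (V G) → Set
Source D v = ∀ u → arc D u v ≡ false
Sink D v = ∀ u → arc D v u ≡ false

module _ {G : Graph} (D : Orientation G) where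

  arc-from-source : ∀ {v} → Source D v → ∀ u → adj G v u ≡ true → arc D v u ≡ true
  arc-from-source src u vu with arc-one D _ u vu
  ... | inj₁ (vu⃗ , _) = vu⃗
  ... | inj₂ (_ , uv⃗) with () ← trans (sym uv⃗) (src u)

  arc-into-sink : ∀ {v} → Sink D v → ∀ u → adj G v u ≡ true → arc D u v ≡ true
  arc-into-sink snk u vu with arc-one D _ u vu
  ... | inj₂ (_ , uv⃗) = uv⃗
  ... | inj₁ (vu⃗ , _) with () ← trans (sym vu⃗) (snk u)

  sources-nonadjacent : ∀ {u v} → Source D u → Source D v → adj G u v ≢ true
  sources-nonadjacent src-u src-v uv with () ← trans (sym (arc-from-source src-u _ uv)) (src-v _)

  sinks-nonadjacent : ∀ {u v} → Sink D u → Sink D v → adj G u v ≢ true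
  sinks-nonadjacent snk-u snk-v uv with () ← trans (sym (arc-into-sink snk-u _ uv)) (snk-v _)

  antiDirected-triangle-free : AntiDirected D → ∀ a b c →
                               adj G a b ≡ true → adj G b c ≡ true → adj G a c ≡ true → ⊥
  antiDirected-triangle-free kind a b c ab bc ac = go (kind a) (kind b) (kind c)
    where
    go : _ → _ → _ → ⊥
    go (inj₁ a↑) (inj₁ b↑) _         = sources-nonadjacent a↑ b↑ ab
    go (inj₁ a↑) (inj₂ _)  (inj₁ c↑) = sources-nonadjacent a↑ c↑ ac
    go (inj₁ _)  (inj₂ b↓) (inj₂ c↓) = sinks-nonadjacent b↓ c↓ bc
    go (inj₂ a↓) (inj₂ b↓) _         = sinks-nonadjacent a↓ b↓ ab
    go (inj₂ a↓) (inj₁ _)  (inj₂ c↓) = sinks-nonadjacent a↓ c↓ ac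
    go (inj₂ _)  (inj₁ b↑) (inj₁ c↑) = sources-nonadjacent b↑ c↑ bc

two-indicators≥2 : ∀ a b → 2 ≤ indicator a + (indicator b + 0) → a ≡ true × b ≡ true
two-indicators≥2 true true _ = refl , refl
two-indicators≥2 true false (s≤s ())
two-indicators≥2 false true (s≤s ())

three-vertices-minDeg≥2-not-antiDirected : (H : Graph) → V H ≡ 3 → MinDeg≥2 H →
  (D : Orientation H) → ¬ AntiDirected D
three-vertices-minDeg≥2-not-antiDirected H refl δ≥2 D anti =
  antiDirected-triangle-free D anti 0F 1F 2F
    (proj₁ nbrs-of-0) (trans (adj-sym H 1F 2F) (proj₂ nbrs-of-2)) (proj₂ nbrs-of-0)
  where
  nbrs-of-0 = two-indicators≥2 (adj H 0F 1F) (adj H 0F 2F)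
    (subst (λ b → 2 ≤ indicator b + (indicator (adj H 0F 1F) + (indicator (adj H 0F 2F) + 0))) (irrefl H 0F) (δ≥2 0F))
  nbrs-of-2 = two-indicators≥2 (adj H 2F 0F) (adj H 2F 1F)
    (subst (λ b → 2 ≤ indicator (adj H 2F 0F) + (indicator (adj H 2F 1F) + (indicator b + 0))) (irrefl H 2F) (δ≥2 2F))

Degenerate : Graph → ℕ → Set
Degenerate G c = ∀ (S : Fin (V G) → Bool) → Σ (Fin (V G)) (λ u → S u ≡ true) →
                 Σ (Fin (V G)) λ x → S x ≡ true × count (λ v → S v ∧ adj G x v) ≤ c

module AntiDirectedAvoidance {H : Graph} (Hₒ : Orientation H) (anti : AntiDirected Hₒ)
  (k : ℕ) (degree>k : ∀ h → k < count (adj H h)) {G : Graph} where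

  CopyIn : (Fin (V G) → Bool) → (Fin (V G) → Fin (V G) → Bool) → Set
  CopyIn S A = Σ (Fin (V H) → Fin (V G)) λ φ →
    Injective _≡_ _≡_ φ × (∀ h → S (φ h) ≡ true) × (∀ u v → arc Hₒ u v ≡ true → A (φ u) (φ v) ≡ true)

  record AvoidingOrientationOn (S : Fin (V G) → Bool) : Set where
    field
      arcs        : Fin (V G) → Fin (V G) → Bool
      arcs-adj    : ∀ u v → arcs u v ≡ true → adj G u v ≡ true
      arcs-inside : ∀ u v → arcs u v ≡ true → S u ≡ true × S v ≡ true
      arcs-oneWay : ∀ u v → adj G u v ≡ true → S u ≡ true → S v ≡ true → OneWay (arcs u v) (arcs v u)
      avoids      : ¬ CopyIn S arcs
  open AvoidingOrientationOn

  neighbourhood-image-count>k : (φ : Fin (V H) → Fin (V G)) → Injective _≡_ _≡_ φ →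
    ∀ h (P : Fin (V G) → Bool) → (∀ u → adj H h u ≡ true → P (φ u) ≡ true) → k < count P
  neighbourhood-image-count>k φ φ-inj h P nbrs⇒P =
    ℕP.<-≤-trans (degree>k h) (count-mono-injective φ φ-inj (adj H h) P nbrs⇒P)

  module Extension (S : Fin (V G) → Bool) (x : Fin (V G)) (Sx : S x ≡ true)
    (sparse : count (λ v → S v ∧ adj G x v) ≤ k + k) (D : AvoidingOrientationOn (S ∖ x)) where

    nbrs out into : Fin (V G) → Bool
    nbrs v = S v ∧ adj G x v
    out = takeFirst k nbrs
    into = dropFirst k nbrs

    arcs′ : Fin (V G) → Fin (V G) → Bool
    arcs′ u v = arcs D u v ∨ ((u == x) ∧ out v ∨ (v == x) ∧ into u)

    arcs-from-x : ∀ v → arcs D x v ≡ false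
    arcs-from-x v with arcs D x v in xv
    ... | false = refl
    ... | true with () ← trans (sym (proj₁ (arcs-inside D x v xv))) (∖-self S x)

    arcs-into-x : ∀ v → arcs D v x ≡ false
    arcs-into-x v with arcs D v x in vx
    ... | false = refl
    ... | true with () ← trans (sym (proj₂ (arcs-inside D v x vx))) (∖-self S x)

    arcs′-from-x : ∀ {v} → v ≢ x → arcs′ x v ≡ out v
    arcs′-from-x {v} v≢x rewrite arcs-from-x v | ==-refl x | ==-≢ v≢x = ∨-identityʳ (out v)

    arcs′-into-x : ∀ {v} → v ≢ x → arcs′ v x ≡ into v
    arcs′-into-x {v} v≢x rewrite arcs-into-x v | ==-refl x | ==-≢ v≢x = refl

    arcs′-away : ∀ {u v} → u ≢ x → v ≢ x → arcs′ u v ≡ arcs D u v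
    arcs′-away {u} {v} u≢x v≢x rewrite ==-≢ u≢x | ==-≢ v≢x = ∨-identityʳ (arcs D u v)

    arcs′-cases : ∀ u v → arcs′ u v ≡ true →
                  arcs D u v ≡ true ⊎ (u ≡ x × out v ≡ true) ⊎ (v ≡ x × into u ≡ true)
    arcs′-cases u v uv⃗ with ∨-∧-cases (arcs D u v) (u == x) (out v) (v == x) (into u) uv⃗
    ... | inj₁ old                 = inj₁ old
    ... | inj₂ (inj₁ (u=x , outv)) = inj₂ (inj₁ (==⇒≡ u=x , outv))
    ... | inj₂ (inj₂ (v=x , intou)) = inj₂ (inj₂ (==⇒≡ v=x , intou))

    out⇒nbrs : ∀ v → out v ≡ true → nbrs v ≡ true
    out⇒nbrs = takeFirst⇒ k nbrs

    into⇒nbrs : ∀ v → into v ≡ true → nbrs v ≡ true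
    into⇒nbrs v = ∧-conicalˡ (nbrs v) _

    arcs′-adj : ∀ u v → arcs′ u v ≡ true → adj G u v ≡ true
    arcs′-adj u v uv⃗ with arcs′-cases u v uv⃗
    ... | inj₁ old                   = arcs-adj D u v old
    ... | inj₂ (inj₁ (refl , outv))  = ∧-conicalʳ (S v) _ (out⇒nbrs v outv)
    ... | inj₂ (inj₂ (refl , intou)) = trans (adj-sym G u v) (∧-conicalʳ (S u) _ (into⇒nbrs u intou))

    arcs′-inside : ∀ u v → arcs′ u v ≡ true → S u ≡ true × S v ≡ true
    arcs′-inside u v uv⃗ with arcs′-cases u v uv⃗
    ... | inj₁ old = let (u∈ , v∈) = arcs-inside D u v old in ∧-conicalˡ (S u) _ u∈ , ∧-conicalˡ (S v) _ v∈
    ... | inj₂ (inj₁ (refl , outv))  = Sx , ∧-conicalˡ (S v) _ (out⇒nbrs v outv)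
    ... | inj₂ (inj₂ (refl , intou)) = ∧-conicalˡ (S u) _ (into⇒nbrs u intou) , Sx

    arcs′-oneWay : ∀ u v → adj G u v ≡ true → S u ≡ true → S v ≡ true → OneWay (arcs′ u v) (arcs′ v u)
    arcs′-oneWay u v uv Su Sv with ≡-or-≢ u x | ≡-or-≢ v x
    ... | inj₁ refl | inj₁ refl with () ← trans (sym uv) (irrefl G u)
    ... | inj₁ refl | inj₂ v≢x = subst₂ OneWay (sym (arcs′-from-x v≢x)) (sym (arcs′-into-x v≢x))
                                (takeFirst-dropFirst-oneWay k nbrs v (cong₂ _∧_ Sv uv))
    ... | inj₂ u≢x | inj₁ refl = subst₂ OneWay (sym (arcs′-into-x u≢x)) (sym (arcs′-from-x u≢x))
                                (OneWay-swap (takeFirst-dropFirst-oneWay k nbrs u (cong₂ _∧_ Su (trans (adj-sym G x u) uv))))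
    ... | inj₂ u≢x | inj₂ v≢x = subst₂ OneWay (sym (arcs′-away u≢x v≢x)) (sym (arcs′-away v≢x u≢x))
                                (arcs-oneWay D u v uv (trans (∖-other S u≢x) Su) (trans (∖-other S v≢x) Sv))

    count-into≤k : count into ≤ k
    count-into≤k = ℕP.≤-trans (count-dropFirst≤ k nbrs)
                     (ℕP.≤-trans (ℕP.∸-monoˡ-≤ k sparse) (ℕP.≤-reflexive (ℕP.m+n∸n≡m k k)))

    arcs′-avoids : ¬ CopyIn S arcs′
    arcs′-avoids (φ , φ-inj , φ∈S , φ-arcs) with any? (λ h → φ h ≟ x)
    ... | no x∉φ = avoids D (φ , φ-inj , φ∈S∖x , φ-arcs′)
      where
      φ∈S∖x : ∀ h → (S ∖ x) (φ h) ≡ true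
      φ∈S∖x h = trans (∖-other S (x∉φ ∘ (h ,_))) (φ∈S h)
      φ-arcs′ : ∀ u v → arc Hₒ u v ≡ true → arcs D (φ u) (φ v) ≡ true
      φ-arcs′ u v uv⃗ = trans (sym (arcs′-away (x∉φ ∘ (u ,_)) (x∉φ ∘ (v ,_)))) (φ-arcs u v uv⃗)
    ... | yes (h , refl) = hub (anti h)
      where
      nbr≢x : ∀ u → adj H h u ≡ true → φ u ≢ φ h
      nbr≢x u hu φu≡φh with φ-inj φu≡φh
      ... | refl with () ← trans (sym hu) (irrefl H h)
      hub : Source Hₒ h ⊎ Sink Hₒ h → ⊥
      hub (inj₁ src) = ℕP.<⇒≱ (neighbourhood-image-count>k φ φ-inj h out
        (λ u hu → trans (sym (arcs′-from-x (nbr≢x u hu))) (φ-arcs h u (arc-from-source Hₒ src u hu))))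
        (count-takeFirst≤ k nbrs)
      hub (inj₂ snk) = ℕP.<⇒≱ (neighbourhood-image-count>k φ φ-inj h into
        (λ u hu → trans (sym (arcs′-into-x (nbr≢x u hu))) (φ-arcs u h (arc-into-sink Hₒ snk u hu))))
        count-into≤k

    extension : AvoidingOrientationOn S
    extension = record { arcs = arcs′ ; arcs-adj = arcs′-adj ; arcs-inside = arcs′-inside
                       ; arcs-oneWay = arcs′-oneWay ; avoids = arcs′-avoids }

  module _ (degenerate : Degenerate G (k + k)) (h₀ : Fin (V H)) where

    peelingOrientation : ∀ m (S : Fin (V G) → Bool) → count S ≡ m → AvoidingOrientationOn S
    peelingOrientation zero S S≡0 = record
      { arcs = λ _ _ → false ; arcs-adj = λ _ _ () ; arcs-inside = λ _ _ ()
      ; arcs-oneWay = λ u _ _ Su _ → ⊥-elim (outside-S u Su)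
      ; avoids = λ (φ , _ , φ∈S , _) → outside-S (φ h₀) (φ∈S h₀) }
      where
      outside-S : ∀ u → S u ≢ true
      outside-S u Su with () ← trans (sym Su) (count≡0⇒false S S≡0 u)
    peelingOrientation (suc m) S S≡1+m with degenerate S (count≡suc⇒witness S S≡1+m)
    ... | x , Sx , sparse = Extension.extension S x Sx sparse
      (peelingOrientation m (S ∖ x) (ℕP.suc-injective (trans (sym (count-∖ S x Sx)) S≡1+m)))

antiDirected-avoidable : ∀ {G H} (Hₒ : Orientation H) → AntiDirected Hₒ →
  ∀ k → (∀ h → k < degree H h) → Fin (V H) → Degenerate G (k + k) →
  Σ (Orientation G) (λ Gₒ → ¬ Copy Hₒ Gₒ)
antiDirected-avoidable {G} {H} Hₒ anti k degree>k h₀ degenerate =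
  record { arc = arcs D ; arc-adj = arcs-adj D ; arc-one = λ u v uv → arcs-oneWay D u v uv refl refl } ,
  λ (φ , φ-inj , φ-arcs) → avoids D (φ , φ-inj , (λ _ → refl) , φ-arcs)
  where
  open AntiDirectedAvoidance Hₒ anti k (λ h → subst (k <_) (count₁≡count (adj H h)) (degree>k h)) {G}
  open AvoidingOrientationOn
  D = peelingOrientation degenerate h₀ (V G) (λ _ → true) (count-const-true (V G))

toℚᵘ-/ : ∀ a b → toℚᵘ (a ℚ./ suc b) ℚᵘ.≃ mkℚᵘ a b
toℚᵘ-/ a b = ℚP.toℚᵘ-fromℚᵘ (mkℚᵘ a b)

/≤⇒cross : ∀ a b q → a ℚ./ suc b ℚ.≤ q → a ℤ.* ↧ q ℤ.≤ ↥ q ℤ.* + suc b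
/≤⇒cross a b (mkℚ _ _ _) a/b≤q with ℚᵘP.≤-respˡ-≃ (toℚᵘ-/ a b) (ℚP.toℚᵘ-mono-≤ a/b≤q)
... | *≤* cross = cross

≤/⇒cross : ∀ a b q → q ℚ.≤ a ℚ./ suc b → ↥ q ℤ.* + suc b ℤ.≤ a ℤ.* ↧ q
≤/⇒cross a b (mkℚ _ _ _) q≤a/b with ℚᵘP.≤-respʳ-≃ (toℚᵘ-/ a b) (ℚP.toℚᵘ-mono-≤ q≤a/b)
... | *≤* cross = cross

/<⇒cross : ∀ a b q → a ℚ./ suc b ℚ.< q → a ℤ.* ↧ q ℤ.< ↥ q ℤ.* + suc b
/<⇒cross a b (mkℚ _ _ _) a/b<q with ℚᵘP.<-respˡ-≃ (toℚᵘ-/ a b) (ℚP.toℚᵘ-mono-< a/b<q)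
... | *<* cross = cross

/≡⇒cross : ∀ a b q → a ℚ./ suc b ≡ q → a ℤ.* ↧ q ≡ ↥ q ℤ.* + suc b
/≡⇒cross a b q a/b≡q = ℤP.≤-antisym (/≤⇒cross a b q (ℚP.≤-reflexive a/b≡q)) (≤/⇒cross a b q (ℚP.≤-reflexive (sym a/b≡q)))

cross⇒/≡ : ∀ a b q → a ℤ.* ↧ q ≡ ↥ q ℤ.* + suc b → a ℚ./ suc b ≡ q
cross⇒/≡ a b (mkℚ _ _ _) cross = ℚP.toℚᵘ-injective (ℚᵘP.≃-trans (toℚᵘ-/ a b) (*≡* cross))

module _ (n d : ℕ) .(c : Coprime n (suc d)) where

  private
    q = mkℚ (+ n) d c
    k = n ℕ./ suc d

  fract≤½⇒ : q ℚ.- (floor q ℚ./ 1) ℚ.≤ ½ → n * 2 ≤ suc (k + k) * suc d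
  fract≤½⇒ fract≤½ = ℤP.drop‿+≤+ (subst₂ ℤ._≤_ lhs rhs (ℤP.+-monoˡ-≤ (K ℤ.* Dz ℤ.* + 2) cross))
    where
    K = + k
    Dz = + suc d
    fract : q ℚ.- (K ℚ./ 1) ℚ.≤ ½
    fract = subst (λ z → q ℚ.- (z ℚ./ 1) ℚ.≤ ½) (div-pos-is-/ℕ (+ n) (suc d)) fract≤½
    toℚᵘ-fract : toℚᵘ (q ℚ.- (K ℚ./ 1)) ℚᵘ.≃ mkℚᵘ (+ n) d ℚᵘ.+ mkℚᵘ (ℤ.- K) 0
    toℚᵘ-fract = ℚᵘP.≃-trans (ℚP.toℚᵘ-homo-+ q (ℚ.- (K ℚ./ 1)))
      (ℚᵘP.+-cong (ℚᵘP.≃-refl {mkℚᵘ (+ n) d}) (ℚᵘP.≃-trans (ℚP.toℚᵘ-homo‿- (K ℚ./ 1)) (ℚᵘP.-‿cong (toℚᵘ-/ K 0))))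
    cross : (+ n ℤ.* + 1 ℤ.+ ℤ.- K ℤ.* Dz) ℤ.* + 2 ℤ.≤ + 1 ℤ.* + suc (d * 1)
    cross with ℚᵘP.≤-respˡ-≃ toℚᵘ-fract (ℚP.toℚᵘ-mono-≤ fract)
    ... | *≤* r = r
    lhs : (+ n ℤ.* + 1 ℤ.+ ℤ.- K ℤ.* Dz) ℤ.* + 2 ℤ.+ K ℤ.* Dz ℤ.* + 2 ≡ + (n * 2)
    lhs = trans (cancel (+ n) K Dz) (sym (ℤP.pos-* n 2))
      where
      cancel : ∀ N K D → (N ℤ.* + 1 ℤ.+ ℤ.- K ℤ.* D) ℤ.* + 2 ℤ.+ K ℤ.* D ℤ.* + 2 ≡ N ℤ.* + 2
      cancel = ℤ-Solver.solve-∀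
    rhs : + 1 ℤ.* + suc (d * 1) ℤ.+ K ℤ.* Dz ℤ.* + 2 ≡ + (suc (k + k) * suc d)
    rhs = begin
      + 1 ℤ.* + suc (d * 1) ℤ.+ K ℤ.* Dz ℤ.* + 2  ≡⟨ cong (λ z → + 1 ℤ.* + suc z ℤ.+ K ℤ.* Dz ℤ.* + 2) (ℕP.*-identityʳ d) ⟩
      + 1 ℤ.* Dz ℤ.+ K ℤ.* Dz ℤ.* + 2             ≡⟨ collect K Dz ⟩
      (+ 1 ℤ.+ (K ℤ.+ K)) ℤ.* Dz                  ≡⟨ cong (ℤ._* Dz) (trans (cong (λ z → + 1 ℤ.+ z) (ℤP.pos-+ k k)) (ℤP.pos-+ 1 (k + k))) ⟨
      + suc (k + k) ℤ.* Dz                        ≡⟨ ℤP.pos-* (suc (k + k)) (suc d) ⟨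
      + (suc (k + k) * suc d)                     ∎
      where
      open ≡-Reasoning
      collect : ∀ K D → + 1 ℤ.* D ℤ.+ K ℤ.* D ℤ.* + 2 ≡ (+ 1 ℤ.+ (K ℤ.+ K)) ℤ.* D
      collect = ℤ-Solver.solve-∀

fraction-<-≤-trans : ∀ e s n D m b → e * suc D < n * s → n * suc b ≤ m * suc D → e * suc b < m * s
fraction-<-≤-trans e s n D m b e/s<n/D n/D≤m/b = ℕP.*-cancelʳ-< (suc D) (e * suc b) (m * s) (begin-strict
  e * suc b * suc D  ≡⟨ reassoc₁ e (suc b) (suc D) ⟩
  suc b * (e * suc D) <⟨ ℕP.*-monoʳ-< (suc b) e/s<n/D ⟩
  suc b * (n * s)    ≡⟨ reassoc₂ (suc b) n s ⟩
  n * suc b * s      ≤⟨ ℕP.*-monoˡ-≤ s n/D≤m/b ⟩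
  m * suc D * s      ≡⟨ reassoc₃ m (suc D) s ⟩
  m * s * suc D      ∎)
  where
  open ℕP.≤-Reasoning
  reassoc₁ : ∀ a b c → a * b * c ≡ b * (a * c)
  reassoc₁ = ℕ-Solver.solve-∀
  reassoc₂ : ∀ a b c → a * (b * c) ≡ b * a * c
  reassoc₂ = ℕ-Solver.solve-∀
  reassoc₃ : ∀ a b c → a * b * c ≡ a * c * b
  reassoc₃ = ℕ-Solver.solve-∀

drop-small-summand : ∀ (a x N b D : ℤ) → (a ℤ.+ x) ℤ.* D ≡ N ℤ.* (+ 1 ℤ.+ b) → x ℤ.* D ℤ.≤ N →
                     N ℤ.* b ℤ.≤ a ℤ.* D
drop-small-summand a x N b D a+x/b+1≡N/D x≤N/D = begin
  N ℤ.* b                              ≡⟨ ℤP.+-identityʳ (N ℤ.* b) ⟨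
  N ℤ.* b ℤ.+ + 0                      ≤⟨ ℤP.+-monoʳ-≤ (N ℤ.* b) (ℤP.i≤j⇒0≤j-i x≤N/D) ⟩
  N ℤ.* b ℤ.+ (N ℤ.- x ℤ.* D)          ≡⟨ expand N b x D ⟩
  N ℤ.* (+ 1 ℤ.+ b) ℤ.- x ℤ.* D        ≡⟨ cong (ℤ._- x ℤ.* D) a+x/b+1≡N/D ⟨
  (a ℤ.+ x) ℤ.* D ℤ.- x ℤ.* D          ≡⟨ cancel a x D ⟩
  a ℤ.* D                              ∎
  where
  open ℤP.≤-Reasoning
  expand : ∀ N b x D → N ℤ.* b ℤ.+ (N ℤ.- x ℤ.* D) ≡ N ℤ.* (+ 1 ℤ.+ b) ℤ.- x ℤ.* D
  expand = ℤ-Solver.solve-∀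
  cancel : ∀ a x D → (a ℤ.+ x) ℤ.* D ℤ.- x ℤ.* D ≡ a ℤ.* D
  cancel = ℤ-Solver.solve-∀

module _ {H : Graph} {q : ℚ} (isM₂ : IsM₂ (full H) q) where

  deleteVertex-attains-m₂ : dens₂ (full H) ≡ q → ∀ w → 4 + w ≡ V H →
    ∀ x → + degree H x ℤ.* ↧ q ℤ.≤ ↥ q → IsM₂ (full H -ᵛ x) q
  deleteVertex-attains-m₂ H≡q w 4+w≡V x deg≤q = IsM₂-attained F isM₂ 3≤vF F≡q
    where
    F = full H -ᵛ x
    d = count (adj H x)
    a = + eJ F ℤ.- + 1
    vH≡ : vJ (full H) ≡ 4 + w
    vH≡ = trans (count₁≡count {V H} (λ _ → true)) (trans (count-const-true (V H)) (sym 4+w≡V))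
    vF≡ : vJ F ≡ 3 + w
    vF≡ = ℕP.suc-injective (trans (sym (vJ-deleteVertex (full H) x refl)) vH≡)
    3≤vF : 3 ≤ vJ F
    3≤vF = subst (3 ≤_) (sym vF≡) (ℕP.m≤m+n 3 w)
    dens₂F : dens₂ F ≡ a ℚ./ suc w
    dens₂F = cong (λ v → frac a (v ∸ 2)) vF≡
    regroup : ∀ A B → (A ℤ.+ B) ℤ.- + 1 ≡ (A ℤ.- + 1) ℤ.+ B
    regroup = ℤ-Solver.solve-∀
    numerator≡ : + eJ (full H) ℤ.- + 1 ≡ a ℤ.+ + d
    numerator≡ = trans (cong (λ e → + e ℤ.- + 1) (eJ-deleteVertex (full H) x))
                   (trans (cong (ℤ._- + 1) (ℤP.pos-+ (eJ F) d)) (regroup (+ eJ F) (+ d)))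
    H-cross : (a ℤ.+ + d) ℤ.* ↧ q ≡ ↥ q ℤ.* (+ 1 ℤ.+ + suc w)
    H-cross = subst₂ (λ A B → A ℤ.* ↧ q ≡ ↥ q ℤ.* B) numerator≡ (ℤP.pos-+ 1 (suc w))
      (/≡⇒cross (+ eJ (full H) ℤ.- + 1) (suc w) q (trans (cong (λ v → frac (+ eJ (full H) ℤ.- + 1) (v ∸ 2)) (sym vH≡)) H≡q))
    lower : ↥ q ℤ.* + suc w ℤ.≤ a ℤ.* ↧ q
    lower = drop-small-summand a (+ d) (↥ q) (+ suc w) (↧ q) H-cross
              (subst (λ e → + e ℤ.* ↧ q ℤ.≤ ↥ q) (count₁≡count (adj H x)) deg≤q)
    upper : a ℤ.* ↧ q ℤ.≤ ↥ q ℤ.* + suc w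
    upper = /≤⇒cross a w q (subst (ℚ._≤ q) dens₂F (proj₂ isM₂ F (⊆ₛ-full {J = F}) 3≤vF))
    F≡q : dens₂ F ≡ q
    F≡q = trans dens₂F (cross⇒/≡ a w q (ℤP.≤-antisym upper lower))

  not-attained-by-proper : StrictlyTwoBalanced H → ∀ F → Proper F → ¬ IsM₂ F q
  not-attained-by-proper stb F F-proper isM₂F = ℚP.<-irrefl refl (stb q isM₂ F F-proper q isM₂F)

degree>⌊m₂⌋ : ∀ {H} n d .(c : Coprime n (suc d)) → StrictlyTwoBalanced H →
  IsM₂ (full H) (mkℚ (+ n) d c) → 4 ≤ V H → ∀ x → n ℕ./ suc d < degree H x
degree>⌊m₂⌋ {H} n d c stb isM₂ 4≤V x with suc (n ℕ./ suc d) ℕP.≤? degree H x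
... | yes ⌊m₂⌋<deg = ⌊m₂⌋<deg
... | no ⌊m₂⌋≮deg with proj₁ isM₂
...   | J , _ , 3≤vJ , J≡q =
  ⊥-elim (not-attained-by-proper isM₂ stb J J-proper (IsM₂-attained J isM₂ 3≤vJ J≡q))
  where
  deg≤q : + degree H x ℤ.* + suc d ℤ.≤ + n
  deg≤q = subst (ℤ._≤ + n) (ℤP.pos-* (degree H x) (suc d))
            (ℤ.+≤+ (ℕP.≤-trans (ℕP.*-monoˡ-≤ (suc d) (ℕP.≤-pred (ℕP.≰⇒> ⌊m₂⌋≮deg))) (m/n*n≤m n (suc d))))
  J-proper : Proper J
  J-proper H⊆J = not-attained-by-proper isM₂ stb (full H -ᵛ x) (-ᵛ-proper (full H) x refl)
    (deleteVertex-attains-m₂ isM₂ (trans (sym (full⊆⇒dens₂≡ J H⊆J)) J≡q) w 4+w≡V x deg≤q)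
    where
    w = proj₁ (ℕP.m≤n⇒∃[o]m+o≡n 4≤V)
    4+w≡V = proj₂ (ℕP.m≤n⇒∃[o]m+o≡n 4≤V)

low-degree-vertex : ∀ {G} (S : Fin (V G) → Bool) c → 2 * eJ (induced G S) < suc c * count S →
  Σ (Fin (V G)) λ x → S x ≡ true × count (λ v → S v ∧ adj G x v) ≤ c
low-degree-vertex {G} S c sparse
  with any? (λ x → (S x Data.Bool.≟ true) ×-dec (count (λ v → S v ∧ adj G x v) ℕP.≤? c))
... | yes found = found
... | no none = ⊥-elim (ℕP.<⇒≱ sparse (begin
  suc c * count S                           ≡⟨ *-distribˡ-sum (suc c) (λ u → indicator (S u)) ⟩
  sum (λ u → suc c * indicator (S u))       ≤⟨ sum-mono-≤ high-degree ⟩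
  sum (λ u → count (es (induced G S) u))    ≡⟨ handshake (induced G S) ⟩
  2 * eJ (induced G S)                      ∎))
  where
  open ℕP.≤-Reasoning
  high-degree : ∀ u → suc c * indicator (S u) ≤ count (es (induced G S) u)
  high-degree u with S u in Su
  ... | false = ℕP.≤-trans (ℕP.≤-reflexive (ℕP.*-zeroʳ (suc c))) z≤n
  ... | true  = subst (_≤ count (λ v → S v ∧ adj G u v)) (sym (ℕP.*-identityʳ (suc c)))
                  (ℕP.≰⇒> (λ low → none (u , Su , low)))

degenerate-below-m : ∀ {G p} n d .(c : Coprime n (suc d)) → IsM (full G) p → p ℚ.< mkℚ (+ n) d c →
  ∀ k → n * 2 ≤ suc k * suc d → Degenerate G k
degenerate-below-m {G} {p} n d c (_ , bound) p<q k q≤[k+1]/2 S (u₀ , Su₀) =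
  low-degree-vertex {G} S k (subst₂ _<_ (ℕP.*-comm e 2) (cong (suc k *_) (sym S≡1+s))
    (fraction-<-≤-trans e (suc s) n d (suc k) 1 e/S<q q≤[k+1]/2))
  where
  e = eJ (induced G S)
  s = count (S ∖ u₀)
  S≡1+s = count-∖ S u₀ Su₀
  vS≡1+s : vJ (induced G S) ≡ suc s
  vS≡1+s = trans (count₁≡count S) S≡1+s
  dens<q : + e ℚ./ suc s ℚ.< mkℚ (+ n) d c
  dens<q = ℚP.≤-<-trans (subst (λ v → frac (+ e) v ℚ.≤ p) vS≡1+s
             (bound (induced G S) (⊆ₛ-full {J = induced G S}) (subst (1 ≤_) (sym vS≡1+s) (s≤s z≤n)))) p<q
  e/S<q : e * suc d < n * suc s
  e/S<q = ℤP.drop‿+<+ (subst₂ ℤ._<_ (sym (ℤP.pos-* e (suc d))) (sym (ℤP.pos-* n (suc s))) (/<⇒cross (+ e) s _ dens<q))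

corollary14 : (G H : Graph) (Hₒ : Orientation H) →
    StrictlyTwoBalanced H → MinDeg≥2 H →
    (q : ℚ) → IsM₂ (full H) q → q ℚ.- (floor q ℚ./ 1) ℚ.≤ ½ →
    AntiDirected Hₒ →
    (p : ℚ) → IsM (full G) p → p ℚ.< q →
    Σ (Orientation G) (λ Gₒ → ¬ Copy Hₒ Gₒ)
corollary14 G H Hₒ stb δ≥2 (mkℚ -[1+ _ ] _ _) _ _ _ p isM p<q =
  ⊥-elim (ℚP.<-asym (ℚP.negative⁻¹ _) (ℚP.≤-<-trans (IsM-nonNegative {F = full G} isM) p<q))
corollary14 G H Hₒ stb δ≥2 (mkℚ (+ n) d c) isM₂ fract≤½ anti p isM p<q
  with ℕP.m≤n⇒m<n∨m≡n (IsM₂⇒3≤V isM₂)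
... | inj₂ 3≡V = ⊥-elim (three-vertices-minDeg≥2-not-antiDirected H (sym 3≡V) δ≥2 Hₒ anti)
... | inj₁ 4≤V = antiDirected-avoidable Hₒ anti k (degree>⌊m₂⌋ n d c stb isM₂ 4≤V)
                   (Data.Fin.fromℕ< {0} (ℕP.≤-trans (s≤s z≤n) 4≤V))
                   (degenerate-below-m n d c isM p<q (k + k) (fract≤½⇒ n d c fract≤½))
  where k = n ℕ./ suc d
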